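{- For every integer $n\geqslant 3$ and every integer $h$ with $0\leqslant h\leqslant n-2$, $\kappa_s^{(h)}(S_{n,2})=n-1$.
   Context: Let $I_n=\{1,\ldots,n\}$ and for $1\leqslant k\leqslant n-1$ let $P(n,k)$ be the set of $k$-permutations $p_1p_2\cdots p_k$ of distinct elements of $I_n$. The $(n,k)$-star graph $S_{n,k}$ has vertex set $P(n,k)$, and a vertex $p=p_1p_2\cdots p_k$ is adjacent to (a) $p_ip_2\cdots p_{i-1}p_1p_{i+1}\cdots p_k$ for each $2\leqslant i\leqslant k$ (swap-edges), and (b) $\alpha p_2\cdots p_k$ for each $\alpha\in I_n\setminus\{p_1,\ldots,p_k\}$ (unswap-edges). For a connected graph $G$ and integer $h\geqslant 0$, a set $S\subseteq V(G)$ is an $h$-cut if $G-S$ is disconnected and has minimum degree at least $h$; $\kappa_s^{(h)}(G)$ is the minimum cardinality of an $h$-cut of $G$. -}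

module Defs where

open import Data.Nat using (ℕ; _≤_)
open import Data.Fin using (Fin)
open import Data.Product using (_×_; _,_; Σ; ∃; ∃-syntax; proj₁; proj₂)
open import Data.Sum using (_⊎_)
open import Data.List using (List; length)
open import Data.List.Membership.Propositional using (_∈_; _∉_)
open import Data.List.Relation.Unary.All using (All)
open import Data.List.Relation.Unary.Unique.Propositional using (Unique)
open import Relation.Binary.PropositionalEquality using (_≡_; _≢_)
open import Relation.Nullary using (¬_)

record Graph : Set₁ where
  field
    V    : Set
    Vert : V → Set
    Adj  : V → V → Set

module _ (G : Graph) where
  open Graph G

  -- A finite vertex set S ⊆ V(G), given as a duplicate-free list;
  -- its cardinality is its length.
  IsVertexSet : List V → Set
  IsVertexSet S = Unique S × All Vert S

  InMinus : List V → V → Set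
  InMinus S v = Vert v × v ∉ S

  -- reachability inside G - S (u assumed in G - S)
  data Reach (S : List V) (u : V) : V → Set where
    here : Reach S u u
    step : ∀ {v w} → Reach S u v → Adj v w → InMinus S w → Reach S u w

  Disconnected-minus : List V → Set
  Disconnected-minus S =
    ∃[ u ] ∃[ v ] (InMinus S u × InMinus S v × ¬ Reach S u v)

  DegMinus≥ : List V → ℕ → V → Set
  DegMinus≥ S h v =
    ∃[ L ] (length L ≡ h × Unique L × All (λ u → InMinus S u × Adj v u) L)

  MinDegMinus≥ : List V → ℕ → Set
  MinDegMinus≥ S h = ∀ v → InMinus S v → DegMinus≥ S h v

  IsHCut : ℕ → List V → Set
  IsHCut h S = IsVertexSet S × Disconnected-minus S × MinDegMinus≥ S h

  κs-is : ℕ → ℕ → Set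
  κs-is h k =
    (∃[ S ] (IsHCut h S × length S ≡ k)) ×
    (∀ S → IsHCut h S → k ≤ length S)

-- The (n,2)-star graph S_{n,2}: vertices are 2-permutations p₁p₂ of I_n
-- (elements of I_n represented by Fin n), i.e. pairs with p₁ ≢ p₂.
-- p₁p₂ ~ p₂p₁ (swap edge) and p₁p₂ ~ αp₂ for α ∉ {p₁,p₂} (unswap edges).
S[_,2] : ℕ → Graph
S[ n ,2] = record
  { V    = Fin n × Fin n
  ; Vert = λ p → proj₁ p ≢ proj₂ p
  ; Adj  = λ p q → (q ≡ (proj₂ p , proj₁ p))
                 ⊎ (proj₂ q ≡ proj₂ p × proj₁ q ≢ proj₁ p × proj₁ q ≢ proj₂ p)
  }

-- Cutting off the n − 1 vertices with head 0 leaves a component of vertices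
-- with tail 0 (a swap edge out of (x,0) leads into the cut), and every remaining
-- vertex keeps n − 2 neighbours. Conversely, take a cut S with fewer than n − 1
-- vertices and two vertices (a,b), (c,d) outside it. Vertices with a common tail
-- form a clique, so assume b ≠ d. For each of the n − 1 heads e ≠ b there is a
-- detour (a,b) ~ (e,b) ~ (b,e) ~ (d,e) ~ (e,d) ~ (c,d); distinct heads give
-- disjoint sets of inner vertices, so by pigeonhole one detour avoids S.
module Submission where

open import Defs
open import Data.Nat using (ℕ; zero; suc; _≤_; _<_; _∸_; _⊓_; s≤s)
open import Data.Nat.Properties using (≮⇒≥; ≤⇒≯; m≤n⇒m⊓n≡m)
open import Data.Fin using (Fin; punchIn; punchOut; _≟_) renaming (zero to fz; suc to fs)
open import Data.Fin.Properties
  using (suc-injective; punchIn-injective; punchInᵢ≢i; punchIn-punchOut; injective⇒≤; all?; ¬∀⟶∃¬)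
open import Data.Product using (_×_; _,_; proj₁; proj₂)
open import Data.Product.Properties using (≡-dec)
open import Data.Sum using (inj₁; inj₂)
open import Data.List using (List; []; _∷_; length; lookup; take; tabulate)
open import Data.List.Properties using (length-take; length-tabulate)
open import Data.List.Membership.Propositional using (_∈_; _∉_; lose; find)
open import Data.List.Membership.Propositional.Properties using (∈-tabulate⁺; ∈-tabulate⁻)
open import Data.List.Relation.Unary.All using (All; []; _∷_)
import Data.List.Relation.Unary.All.Properties as All
open import Data.List.Relation.Unary.All.Properties using (¬Any⇒All¬)
open import Data.List.Relation.Unary.Any using (Any; here; there; any?)
open import Data.List.Relation.Unary.Any.Properties using (lookup-index)
open import Data.List.Relation.Unary.AllPairs using (_∷_)
import Data.List.Relation.Unary.Unique.Propositional.Properties as Unique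
open import Data.Empty using (⊥-elim)
open import Relation.Nullary using (¬_; Dec; yes; no)
open import Relation.Binary.Definitions using (DecidableEquality)
open import Relation.Binary.PropositionalEquality using (_≡_; _≢_; refl; sym; trans; cong; subst)
open import Function using (_∘_)

module _ {A : Set} where

  ≤length-of-disjoint-hits : ∀ {k} (Q : Fin k → A → Set) {S : List A} →
                             (∀ {i j x} → Q i x → Q j x → i ≡ j) →
                             (∀ i → Any (Q i) S) → k ≤ length S
  ≤length-of-disjoint-hits Q {S} disjoint hit = injective⇒≤ λ {i} {j} same-index →
    disjoint (lookup-index (hit i))
             (subst (Q j ∘ lookup S) (sym same-index) (lookup-index (hit j)))

module _ (G : Graph) where
  open Graph G

  Connected-minus : List V → Set
  Connected-minus S = ∀ {u v} → InMinus G S u → InMinus G S v → Reach G S u v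

  DegMinus≥-mono : ∀ {S h k v} → h ≤ k → DegMinus≥ G S k v → DegMinus≥ G S h v
  DegMinus≥-mono {h = h} h≤k (L , |L|≡k , unique , all) =
    take h L ,
    trans (length-take h L) (trans (cong (h ⊓_) |L|≡k) (m≤n⇒m⊓n≡m h≤k)) ,
    Unique.take⁺ h unique , All.take⁺ h all

  κs-is-intro : ∀ {h k} S → IsHCut G h S → length S ≡ k →
                (∀ S → length S < k → Connected-minus S) → κs-is G h k
  κs-is-intro S cut |S|≡k small-connected =
    (S , cut , |S|≡k) ,
    λ { S′ (_ , (u , v , u∈ , v∈ , u↛v) , _) →
          ≮⇒≥ λ |S′|<k → u↛v (small-connected S′ |S′|<k u∈ v∈) }

module _ {n : ℕ} {S : List (Fin n × Fin n)} where

  reach-swap : ∀ {u x y} → Reach S[ n ,2] S u (x , y) → InMinus S[ n ,2] S (y , x) →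
               Reach S[ n ,2] S u (y , x)
  reach-swap r yx∈ = step r (inj₁ refl) yx∈

  reach-unswap : ∀ {u x y z} → Reach S[ n ,2] S u (x , y) → InMinus S[ n ,2] S (z , y) →
                 Reach S[ n ,2] S u (z , y)
  reach-unswap {x = x} {z = z} r zy∈ with z ≟ x
  ... | yes refl = r
  ... | no z≢x   = step r (inj₂ (refl , z≢x , proj₁ zy∈)) zy∈

module SmallCutsConnect (n′ : ℕ) where
  F : Set
  F = Fin (suc n′)

  G : Graph
  G = S[ suc n′ ,2]

  _≟ᵥ_ : DecidableEquality (F × F)
  _≟ᵥ_ = ≡-dec _≟_ _≟_

  open import Data.List.Membership.DecPropositional _≟ᵥ_ using (_∈?_)

  module _ {b d : F} (b≢d : b ≢ d) where

    detour : F → List (F × F)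
    detour e = (e , b) ∷ (b , e) ∷ (d , e) ∷ (e , d) ∷ []

    data OnDetour (e : F) : F × F → Set where
      eb : OnDetour e (e , b)
      be : OnDetour e (b , e)
      de : OnDetour e (d , e)
      ed : OnDetour e (e , d)

    on-detour : ∀ {e s} → s ∈ detour e → OnDetour e s
    on-detour (here refl)                         = eb
    on-detour (there (here refl))                 = be
    on-detour (there (there (here refl)))         = de
    on-detour (there (there (there (here refl)))) = ed

    detours-disjoint : ∀ {e e′ s} → e ≢ b → e′ ≢ b →
                       OnDetour e s → OnDetour e′ s → e ≡ e′
    detours-disjoint e≢b e′≢b eb eb = refl
    detours-disjoint e≢b e′≢b eb be = ⊥-elim (e≢b refl)
    detours-disjoint e≢b e′≢b eb de = ⊥-elim (e′≢b refl)
    detours-disjoint e≢b e′≢b eb ed = ⊥-elim (b≢d refl)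
    detours-disjoint e≢b e′≢b be eb = ⊥-elim (e′≢b refl)
    detours-disjoint e≢b e′≢b be be = refl
    detours-disjoint e≢b e′≢b be de = ⊥-elim (b≢d refl)
    detours-disjoint e≢b e′≢b be ed = ⊥-elim (e′≢b refl)
    detours-disjoint e≢b e′≢b de eb = ⊥-elim (e≢b refl)
    detours-disjoint e≢b e′≢b de be = ⊥-elim (b≢d refl)
    detours-disjoint e≢b e′≢b de de = refl
    detours-disjoint e≢b e′≢b de ed = refl
    detours-disjoint e≢b e′≢b ed eb = ⊥-elim (b≢d refl)
    detours-disjoint e≢b e′≢b ed be = ⊥-elim (e≢b refl)
    detours-disjoint e≢b e′≢b ed de = refl
    detours-disjoint e≢b e′≢b ed ed = refl

    Blocked : List (F × F) → F → Set
    Blocked S e = Any (_∈ S) (detour e)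

    blocked? : ∀ S e → Dec (Blocked S e)
    blocked? S e = any? (_∈? S) (detour e)

    blocker-on-detour : ∀ {S e} → Blocked S e → Any (OnDetour e) S
    blocker-on-detour blocked =
      let s , s∈detour , s∈S = find blocked in lose s∈S (on-detour s∈detour)

    reach-via-detour : ∀ {S a c} e → e ≢ b → ¬ Blocked S e →
                       InMinus G S (a , b) → InMinus G S (c , d) → Reach G S (a , b) (c , d)
    reach-via-detour e e≢b unblocked ab∈ cd∈
      with ¬Any⇒All¬ (detour e) unblocked | e ≟ d
    -- for e = d the detour degenerates to (a,b) ~ (d,b) ~ (b,d) ~ (c,d)
    ... | eb∉ ∷ be∉ ∷ _ | yes refl =
      reach-unswap (reach-swap (reach-unswap here (e≢b , eb∉)) (b≢d , be∉)) cd∈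
    ... | eb∉ ∷ be∉ ∷ de∉ ∷ ed∉ ∷ [] | no e≢d =
      reach-unswap
        (reach-swap
          (reach-unswap (reach-swap (reach-unswap here (e≢b , eb∉)) (e≢b ∘ sym , be∉))
                        (e≢d ∘ sym , de∉))
          (e≢d , ed∉))
        cd∈

  small-cut-connected : ∀ S → length S < n′ → Connected-minus G S
  small-cut-connected S |S|<n′ {a , b} {c , d} ab∈ cd∈ with b ≟ d
  ... | yes refl = reach-unswap here cd∈
  ... | no b≢d with all? (blocked? b≢d S ∘ punchIn b)
  ...   | no some-unblocked =
    let i , unblocked = ¬∀⟶∃¬ n′ _ (blocked? b≢d S ∘ punchIn b) some-unblocked
    in reach-via-detour b≢d (punchIn b i) (punchInᵢ≢i b i) unblocked ab∈ cd∈
  ...   | yes all-blocked = ⊥-elim (≤⇒≯ (≤length-of-disjoint-hits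
            (λ i → OnDetour b≢d (punchIn b i))
            (λ p q → punchIn-injective b _ _
                       (detours-disjoint b≢d (punchInᵢ≢i b _) (punchInᵢ≢i b _) p q))
            (blocker-on-detour b≢d ∘ all-blocked)) |S|<n′)

module HeadCut (m : ℕ) where
  F : Set
  F = Fin (suc (suc (suc m)))

  G : Graph
  G = S[ suc (suc (suc m)) ,2]

  zeroHead : Fin (suc (suc m)) → F × F
  zeroHead i = (fz , fs i)

  headCut : List (F × F)
  headCut = tabulate zeroHead

  length-headCut : length headCut ≡ suc (suc m)
  length-headCut = length-tabulate zeroHead

  ∈-headCut : ∀ {y} → y ≢ fz → (fz , y) ∈ headCut
  ∈-headCut {fz}   y≢0 = ⊥-elim (y≢0 refl)
  ∈-headCut {fs y} _   = ∈-tabulate⁺ {f = zeroHead} y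

  ∉-headCut : ∀ {x y} → x ≢ fz → (x , y) ∉ headCut
  ∉-headCut x≢0 xy∈ = let _ , eq = ∈-tabulate⁻ {f = zeroHead} xy∈ in x≢0 (cong proj₁ eq)

  headCut-vertexSet : IsVertexSet G headCut
  headCut-vertexSet =
    Unique.tabulate⁺ {f = zeroHead} (suc-injective ∘ cong proj₂) ,
    All.tabulate⁺ {f = zeroHead} (λ _ ())

  reach-keeps-tail0 : ∀ {u w} → proj₂ u ≡ fz → Reach G headCut u w → proj₂ w ≡ fz
  reach-keeps-tail0 u-tail0 here = u-tail0
  reach-keeps-tail0 u-tail0 (step r (inj₁ refl) (x≢0 , 0x∉))
    with refl ← reach-keeps-tail0 u-tail0 r = ⊥-elim (0x∉ (∈-headCut (x≢0 ∘ sym)))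
  reach-keeps-tail0 u-tail0 (step r (inj₂ (same-tail , _)) _) =
    trans same-tail (reach-keeps-tail0 u-tail0 r)

  headCut-disconnects : Disconnected-minus G headCut
  headCut-disconnects =
    (fs fz , fz) , (fs fz , fs (fs fz)) ,
    ((λ ()) , ∉-headCut (λ ())) , ((λ ()) , ∉-headCut (λ ())) ,
    λ r → tail≢0 (reach-keeps-tail0 refl r)
    where
    tail≢0 : fs (fs fz) ≢ fz
    tail≢0 ()

  headCut-minDeg : MinDegMinus≥ G headCut (suc m)
  headCut-minDeg (fz , y) (0≢y , 0y∉) = ⊥-elim (0y∉ (∈-headCut (0≢y ∘ sym)))
  headCut-minDeg (fs x , fz) _ =
    tabulate neighbour , length-tabulate neighbour ,
    Unique.tabulate⁺ {f = neighbour}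
      (λ eq → punchIn-injective x _ _ (suc-injective (cong proj₁ eq))) ,
    All.tabulate⁺ {f = neighbour}
      (λ j → ((λ ()) , ∉-headCut (λ ())) , inj₂ (refl , punchInᵢ≢i x j ∘ suc-injective , (λ ())))
    where
    neighbour : Fin (suc m) → F × F
    neighbour j = (fs (punchIn x j) , fz)
  headCut-minDeg (fs x , fs y) (x≢y , _) =
    (fs y , fs x) ∷ tabulate neighbour , cong suc (length-tabulate neighbour) ,
    (All.tabulate⁺ (λ j eq → x≢y (cong proj₂ eq)) ∷
     Unique.tabulate⁺ {f = neighbour}
       (λ eq → punchIn-injective y′ _ _ (punchIn-injective x _ _ (suc-injective (cong proj₁ eq))))) ,
    ((x≢y ∘ sym , ∉-headCut (λ ())) , inj₁ refl) ∷
    All.tabulate⁺ {f = neighbour}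
      (λ j → (α≢y j , ∉-headCut (λ ())) , inj₂ (refl , punchInᵢ≢i x _ ∘ suc-injective , α≢y j))
    where
    y′ : Fin (suc m)
    y′ = punchOut (x≢y ∘ cong fs)
    -- α enumerates the heads other than 0, x and y
    α : Fin m → F
    α j = fs (punchIn x (punchIn y′ j))
    α≢y : ∀ j → α j ≢ fs y
    α≢y j eq = punchInᵢ≢i y′ j (punchIn-injective x _ _
                 (trans (suc-injective eq) (sym (punchIn-punchOut (x≢y ∘ cong fs)))))
    neighbour : Fin m → F × F
    neighbour j = (α j , fs y)

  headCut-isHCut : ∀ h → h ≤ suc m → IsHCut G h headCut
  headCut-isHCut h h≤ =
    headCut-vertexSet , headCut-disconnects ,
    λ v v∈ → DegMinus≥-mono G h≤ (headCut-minDeg v v∈)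

corollary3p2 : (n h : ℕ) → 3 ≤ n → h ≤ n ∸ 2 → κs-is S[ n ,2] h (n ∸ 1)
corollary3p2 (suc zero)       h (s≤s ())         _
corollary3p2 (suc (suc zero)) h (s≤s (s≤s ())) _
corollary3p2 (suc (suc (suc m))) h _ h≤n-2 =
  κs-is-intro G headCut (headCut-isHCut h h≤n-2) length-headCut
              (SmallCutsConnect.small-cut-connected (suc (suc m)))
  where open HeadCut m
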